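{- For all positive integers $k,m$, every positive integer $\ell$ and all integers $n_1,\ldots,n_\ell\geq 2$, $$R(B_{k,m},K_{n_1},\ldots,K_{n_\ell})=(k+m-1)\bigl[R(K_{n_1},\ldots,K_{n_\ell})-1\bigr]+1.$$
   Context: For graphs $G_1,\ldots,G_s$, $R(G_1,\ldots,G_s)$ is the least integer $N$ such that every edge-coloring of $K_N$ with $s$ colors $1,\ldots,s$ contains, for some $i$, a copy of $G_i$ all of whose edges have color $i$. $B_{k,m}$ denotes the bistar on $k+m$ vertices: a vertex $v$ of degree $k$, a vertex $w$ adjacent to $v$ of degree $m$, and $k+m-2$ further vertices of degree $1$. $K_n$ is the complete graph on $n$ vertices. -}

module Defs where

open import Level using (0ℓ)
open import Data.Nat using (ℕ; zero; suc; _+_; _≤_; _<_)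
open import Data.Fin using (Fin; toℕ)
open import Data.List using (List; length; lookup; map)
open import Data.Product using (Σ; _×_; _,_)
open import Data.Sum using (_⊎_)
open import Relation.Binary.PropositionalEquality using (_≡_; _≢_)
open import Function.Definitions using (Injective)

record Graph : Set₁ where
  field
    size : ℕ
    Adj  : Fin size → Fin size → Set

open Graph public

K : ℕ → Graph
K n = record { size = n ; Adj = λ u v → u ≢ v }

-- Bistar B_{k,m} on k+m vertices: vertex 0 (= v, degree k) adjacent to
-- vertex 1 (= w, degree m); vertices 2,…,k are leaves at v; vertices
-- k+1,…,k+m-1 are leaves at w.
BistarEdge : ℕ → ℕ → ℕ → Set
BistarEdge k x y =
  (x ≡ 0 × y ≡ 1)
  ⊎ (x ≡ 0 × 2 ≤ y × y < k + 1)
  ⊎ (x ≡ 1 × k + 1 ≤ y)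

B : ℕ → ℕ → Graph
B k m = record
  { size = k + m
  ; Adj  = λ a b → BistarEdge k (toℕ a) (toℕ b) ⊎ BistarEdge k (toℕ b) (toℕ a) }

-- An edge-colouring of K_N with s colours: a symmetric map on pairs
-- (values on the diagonal are irrelevant).
record Colouring (N s : ℕ) : Set where
  field
    col : Fin N → Fin N → Fin s
    sym : ∀ x y → col x y ≡ col y x

open Colouring public

MonoCopy : ∀ {N s} → Colouring N s → Fin s → Graph → Set
MonoCopy {N} c i G =
  Σ (Fin (size G) → Fin N) λ f →
    Injective _≡_ _≡_ f × (∀ u v → Adj G u v → col c (f u) (f v) ≡ i)

Arrows : ℕ → List Graph → Set
Arrows N Gs = (c : Colouring N (length Gs)) →
  Σ (Fin (length Gs)) λ i → MonoCopy c i (lookup Gs i)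

IsRamseyNumber : ℕ → List Graph → Set
IsRamseyNumber r Gs = Arrows r Gs × (∀ N → Arrows N Gs → r ≤ N)

module Submission where

-- Write d = k+m-1 and r = t+1.  Colour 0 is reserved for the bistar.
--
-- Upper bound (N = t·d + 1 vertices suffice).  Two adjacent vertices of degree
-- ≥ d span a B_{k,m}.  So if the colour-0 graph has no B_{k,m}, every nonempty
-- vertex set contains a vertex of degree < d; keeping such a vertex and deleting
-- its closed neighbourhood (≤ d vertices) t+1 times gives a colour-0 independent
-- set of size t+1, on which the other colours contain a monochromatic K_{n_j}.
--
-- Lower bound (N ≤ t·d vertices do not).  Blow each vertex of a K-free colouring
-- of K_t up into a block of d vertices, with colour 0 inside blocks.  B_{k,m} is
-- connected, so a colour-0 copy would fit into one block of d < k+m vertices; a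
-- K_{n_j} in colour j+1 meets every block at most once and projects back to K_t.

open import Defs hiding (sym)
open import Level using (0ℓ)
open import Data.Nat using (ℕ; zero; suc; _+_; _*_; _∸_; _≤_; _<_; z≤n; s≤s; _≤?_; _<?_)
import Data.Nat as ℕ
open import Data.Nat.Properties using (+-suc; +-comm; *-comm; +-monoˡ-≤; +-monoʳ-≤; +-cancelˡ-<; +-cancelʳ-≤; +-cancelʳ-<; ≤-pred; ≤-trans; ≤-reflexive; m≤n+m; m≤n⇒m⊓n≡m; m≤n⇒∃[o]m+o≡n; ≰⇒>; ≮⇒≥; <⇒≱; n≮n; module ≤-Reasoning)
open import Data.Fin using (Fin; zero; suc; toℕ; fromℕ<; inject≤; remQuot; combine; _≟_)
open import Data.Fin.Properties using (toℕ-injective; toℕ<n; toℕ-fromℕ<; combine-remQuot; inject≤-injective; injective⇒≤; suc-injective)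
open import Data.List using (List; []; _∷_; [_]; _++_; length; map; lookup; filter; take; allFin)
open import Data.List.Properties using (length-++; length-take; length-tabulate)
open import Data.List.Relation.Unary.All as All using (All; []; _∷_)
import Data.List.Relation.Unary.All.Properties as Allₚ
open import Data.List.Relation.Unary.All.Properties using (all-filter)
open import Data.List.Relation.Unary.AllPairs as AllPairs using (AllPairs; []; _∷_)
import Data.List.Relation.Unary.AllPairs.Properties as AllPairsₚ
open import Data.List.Relation.Unary.Any using (here; there)
open import Data.List.Relation.Unary.Unique.Propositional using (Unique)
import Data.List.Relation.Unary.Unique.Propositional.Properties as Unique
open import Data.List.Membership.Propositional using (_∈_; _∉_)
open import Data.List.Membership.Propositional.Properties using (∈-∃++; ∈-++⁻; ∈-++⁺ˡ; ∈-++⁺ʳ; ∈-filter⁺; ∈-filter⁻)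
open import Data.Product using (Σ; _×_; _,_; proj₁; proj₂; uncurry)
open import Data.Sum using (_⊎_; inj₁; inj₂)
open import Data.Empty using (⊥; ⊥-elim)
open import Function using (_∘_)
open import Function.Definitions using (Injective)
open import Relation.Nullary using (¬_; ¬?; Dec; yes; no; _×-dec_)
open import Relation.Unary using (Pred; Decidable)
open import Relation.Binary.Definitions using (DecidableEquality)
open import Relation.Binary.PropositionalEquality using (_≡_; _≢_; refl; sym; trans; cong; cong₂; subst; ≢-sym; module ≡-Reasoning)

module ListFacts {A : Set} where

  length-take-≤ : ∀ n (xs : List A) → n ≤ length xs → length (take n xs) ≡ n
  length-take-≤ n xs n≤ = trans (length-take n xs) (m≤n⇒m⊓n≡m n≤)

  member : ∀ (xs : List A) → 0 < length xs → Σ A (_∈ xs)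
  member (x ∷ _) _ = x , here refl

  filter-All : ∀ {P Q : Pred A 0ℓ} (P? : Decidable P) {xs} → All Q xs → All (λ x → P x × Q x) (filter P? xs)
  filter-All P? {xs} Qxs = All.zip (all-filter P? xs , Allₚ.filter⁺ P? Qxs)

  nth : A → List A → ℕ → A
  nth d [] _ = d
  nth d (x ∷ xs) zero = x
  nth d (x ∷ xs) (suc i) = nth d xs i

  nth-All : ∀ {P : Pred A 0ℓ} d {xs} → All P xs → ∀ {i} → i < length xs → P (nth d xs i)
  nth-All d (px ∷ _) {zero} _ = px
  nth-All d (_ ∷ pxs) {suc i} (s≤s i<) = nth-All d pxs i<

  nth-++ˡ : ∀ d xs ys {i} → i < length xs → nth d (xs ++ ys) i ≡ nth d xs i
  nth-++ˡ d (x ∷ xs) ys {zero} _ = refl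
  nth-++ˡ d (x ∷ xs) ys {suc i} (s≤s i<) = nth-++ˡ d xs ys i<

  nth-++ʳ : ∀ d xs ys i → nth d (xs ++ ys) (length xs + i) ≡ nth d ys i
  nth-++ʳ d [] ys i = refl
  nth-++ʳ d (x ∷ xs) ys i = nth-++ʳ d xs ys i

  nth-AllPairs : ∀ {R : A → A → Set} → (∀ {x y} → R x y → R y x) → ∀ d {xs} → AllPairs R xs →
                 ∀ {i j} → i < length xs → j < length xs → i ≢ j → R (nth d xs i) (nth d xs j)
  nth-AllPairs R-sym d (_ ∷ _) {zero} {zero} _ _ i≢j = ⊥-elim (i≢j refl)
  nth-AllPairs R-sym d (Rx ∷ _) {zero} {suc j} _ (s≤s j<) _ = nth-All d Rx j<
  nth-AllPairs R-sym d (Rx ∷ _) {suc i} {zero} (s≤s i<) _ _ = R-sym (nth-All d Rx i<)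
  nth-AllPairs R-sym d (_ ∷ Rxs) {suc i} {suc j} (s≤s i<) (s≤s j<) i≢j =
    nth-AllPairs R-sym d Rxs i< j< (λ i≡j → i≢j (cong suc i≡j))

  nth-injective : ∀ d {xs} → Unique xs → ∀ {i j} → i < length xs → j < length xs →
                  nth d xs i ≡ nth d xs j → i ≡ j
  nth-injective d xs! {i} {j} i< j< eq with i ℕ.≟ j
  ... | yes i≡j = i≡j
  ... | no i≢j = ⊥-elim (nth-AllPairs ≢-sym d xs! i< j< i≢j eq)

module UniqueLists {A : Set} (_≟_ : DecidableEquality A) where

  open import Data.List.Membership.DecPropositional _≟_ using (_∈?_; _∉?_)

  length-filter-split : {P : Pred A 0ℓ} (P? : Decidable P) (xs : List A) →
                        length (filter P? xs) + length (filter (λ x → ¬? (P? x)) xs) ≡ length xs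
  length-filter-split P? [] = refl
  length-filter-split P? (x ∷ xs) with P? x
  ... | yes _ = cong suc (length-filter-split P? xs)
  ... | no _ = trans (+-suc _ _) (cong suc (length-filter-split P? xs))

  unique-⊆-length : ∀ {xs ys : List A} → Unique xs → (∀ {x} → x ∈ xs → x ∈ ys) → length xs ≤ length ys
  unique-⊆-length {[]} _ _ = z≤n
  unique-⊆-length {x ∷ xs} (x∉xs ∷ xs!) xs⊆ys with ∈-∃++ (xs⊆ys (here refl))
  ... | ys₁ , ys₂ , refl = begin
    suc (length xs)                  ≤⟨ s≤s (unique-⊆-length xs! xs⊆ys₁ys₂) ⟩
    suc (length (ys₁ ++ ys₂))        ≡⟨ cong suc (length-++ ys₁) ⟩
    suc (length ys₁ + length ys₂)    ≡⟨ sym (+-suc (length ys₁) (length ys₂)) ⟩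
    length ys₁ + length (x ∷ ys₂)    ≡⟨ sym (length-++ ys₁) ⟩
    length (ys₁ ++ x ∷ ys₂)          ∎
    where
    open ≤-Reasoning
    -- every y ∈ xs differs from x, so it survives the removal of x from ys
    xs⊆ys₁ys₂ : ∀ {y} → y ∈ xs → y ∈ ys₁ ++ ys₂
    xs⊆ys₁ys₂ y∈xs with ∈-++⁻ ys₁ (xs⊆ys (there y∈xs))
    ... | inj₁ y∈ys₁ = ∈-++⁺ˡ y∈ys₁
    ... | inj₂ (here refl) = ⊥-elim (All.lookup x∉xs y∈xs refl)
    ... | inj₂ (there y∈ys₂) = ∈-++⁺ʳ ys₁ y∈ys₂

  length-filter-∉ : ∀ {xs} (ys : List A) → Unique xs → length xs ≤ length (filter (_∉? ys) xs) + length ys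
  length-filter-∉ {xs} ys xs! = begin
    length xs                                  ≡⟨ sym (length-filter-split (_∈? ys) xs) ⟩
    length inside + length out                 ≤⟨ +-monoˡ-≤ (length out) inside≤ys ⟩
    length ys + length out                     ≡⟨ +-comm (length ys) (length out) ⟩
    length out + length ys                     ∎
    where
    open ≤-Reasoning
    inside out : List A
    inside = filter (_∈? ys) xs
    out = filter (_∉? ys) xs
    inside≤ys : length inside ≤ length ys
    inside≤ys = unique-⊆-length (Unique.filter⁺ (_∈? ys) xs!)
                                (λ x∈inside → proj₂ (∈-filter⁻ (_∈? ys) {xs = xs} x∈inside))

Embeds : {X : Set} → Graph → (X → X → Set) → Set
Embeds {X} G E = Σ (Fin (size G) → X) λ f → Injective _≡_ _≡_ f × (∀ u v → Adj G u v → E (f u) (f v))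

SomeMonoCopy : ∀ {N} (Gs : List Graph) → Colouring N (length Gs) → Set
SomeMonoCopy Gs c = Σ (Fin (length Gs)) λ i → MonoCopy c i (lookup Gs i)

module BistarOrIndependent {X : Set} (_≟_ : DecidableEquality X)
    (E : X → X → Set) (E? : ∀ x y → Dec (E x y)) (E-sym : ∀ {x y} → E x y → E y x)
    (k' m' : ℕ) where

  open ListFacts
  open UniqueLists _≟_
  open import Data.List.Membership.DecPropositional _≟_ using (_∉?_)

  -- e = k+m-2 bounds the degrees in a B_{k,m}-free graph; d = k+m-1.
  k m e d : ℕ
  k = suc k'
  m = suc m'
  e = k' + m'
  d = suc e

  -- u ∼ w together with k' further neighbours P of u and m' further
  -- neighbours Q of w, all distinct, span a B_{k,m}:
  -- position 0 ↦ u, 1 ↦ w, 2…k ↦ P, k+1…k+m-1 ↦ Q.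
  bistar-from-leaves : ∀ u w P Q → E u w → length P ≡ k' → length Q ≡ m' →
                       All (E u) P → All (E w) Q → Unique (u ∷ w ∷ P ++ Q) → Embeds (B k m) E
  bistar-from-leaves u w P Q Euw |P| |Q| EuP EwQ L! = f , f-injective , f-edge
    where
    L : List X
    L = u ∷ w ∷ P ++ Q

    vertex : ℕ → X
    vertex = nth u L

    |L| : length L ≡ k + m
    |L| = begin
      suc (suc (length (P ++ Q)))      ≡⟨ cong (2 +_) (length-++ P) ⟩
      suc (suc (length P + length Q))  ≡⟨ cong (2 +_) (cong₂ _+_ |P| |Q|) ⟩
      suc (suc (k' + m'))              ≡⟨ cong suc (sym (+-suc k' m')) ⟩
      k + m                            ∎
      where open ≡-Reasoning

    in-range : ∀ (a : Fin (k + m)) → toℕ a < length L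
    in-range a = subst (toℕ a <_) (sym |L|) (toℕ<n a)

    f : Fin (k + m) → X
    f a = vertex (toℕ a)

    f-injective : Injective _≡_ _≡_ f
    f-injective {a} {b} fa≡fb = toℕ-injective (nth-injective u L! (in-range a) (in-range b) fa≡fb)

    -- the leaves of u occupy positions 2 + y with y < k'
    u-leaf : ∀ {y} → 2 + y < k + 1 → y < length P
    u-leaf {y} (s≤s 2+y<k'+1) = subst (y <_) (sym |P|) (≤-pred (subst (2 + y ≤_) (+-comm k' 1) 2+y<k'+1))

    -- the leaves of w occupy positions 2 + (k' + z) with z < m'
    w-leaf : ∀ y → k + 1 ≤ y → y < k + m → Σ ℕ λ z → y ≡ 2 + (k' + z) × z < length Q
    w-leaf y k+1≤y y<k+m with m≤n⇒∃[o]m+o≡n (subst (_≤ y) (cong suc (+-comm k' 1)) k+1≤y)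
    ... | z , refl = z , refl , subst (z <_) (sym |Q|)
          (+-cancelˡ-< (2 + k') z m' (subst (2 + (k' + z) <_) (cong suc (+-suc k' m')) y<k+m))

    edge : ∀ x y → y < k + m → BistarEdge k x y → E (vertex x) (vertex y)
    edge .0 .1 _ (inj₁ (refl , refl)) = Euw
    edge .0 (suc (suc y)) _ (inj₂ (inj₁ (refl , _ , 2+y<k+1))) =
      subst (E u) (sym (nth-++ˡ u P Q (u-leaf 2+y<k+1))) (nth-All u EuP (u-leaf 2+y<k+1))
    edge _ (suc zero) _ (inj₂ (inj₁ (_ , s≤s () , _)))
    edge .1 y y<k+m (inj₂ (inj₂ (refl , k+1≤y))) with w-leaf y k+1≤y y<k+m
    ... | z , refl , z<|Q| =
      subst (λ n → E w (nth u (P ++ Q) (n + z))) |P|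
        (subst (E w) (sym (nth-++ʳ u P Q z)) (nth-All u EwQ z<|Q|))

    f-edge : ∀ a b → Adj (B k m) a b → E (f a) (f b)
    f-edge a b (inj₁ ab) = edge (toℕ a) (toℕ b) (toℕ<n b) ab
    f-edge a b (inj₂ ba) = E-sym (edge (toℕ b) (toℕ a) (toℕ<n a) ba)

  -- v ∼ x: x is an E-neighbour of v other than v (E may hold on the diagonal).
  Adjacent : X → X → Set
  Adjacent v x = x ≢ v × E v x

  Adjacent? : ∀ v x → Dec (Adjacent v x)
  Adjacent? v x = ¬? (x ≟ v) ×-dec E? v x

  nbr : X → List X → List X
  nbr v = filter (Adjacent? v)

  nbr-unique : ∀ v {V} → Unique V → Unique (nbr v V)
  nbr-unique v = Unique.filter⁺ (Adjacent? v)

  -- Two adjacent vertices of degree > e = k+m-2 carry a B_{k,m}: take m-1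
  -- neighbours Q of w other than u, then k-1 neighbours P of u outside w ∷ Q.
  bistar-from-degrees : ∀ {V} → Unique V → ∀ {u w} → Adjacent u w →
                        e < length (nbr u V) → e < length (nbr w V) → Embeds (B k m) E
  bistar-from-degrees {V} V! {u} {w} (w≢u , Euw) deg-u deg-w =
    bistar-from-leaves u w P Q Euw |P| |Q|
      (All.map (proj₂ ∘ proj₂) P-facts) (All.map (proj₂ ∘ proj₂) Q-facts) L!
    where
    Q-pool P-pool Q P : List X
    Q-pool = filter (_∉? [ u ]) (nbr w V)
    Q = take m' Q-pool
    P-pool = filter (_∉? w ∷ Q) (nbr u V)
    P = take k' P-pool

    Q-facts : All (λ x → x ∉ [ u ] × Adjacent w x) Q
    Q-facts = Allₚ.take⁺ m' (filter-All (_∉? [ u ]) (all-filter (Adjacent? w) V))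

    P-facts : All (λ x → x ∉ w ∷ Q × Adjacent u x) P
    P-facts = Allₚ.take⁺ k' (filter-All (_∉? w ∷ Q) (all-filter (Adjacent? u) V))

    |Q| : length Q ≡ m'
    |Q| = length-take-≤ m' Q-pool (≤-trans (m≤n+m m' k') (≤-pred (subst (d ≤_) (+-comm (length Q-pool) 1) d≤)))
      where
      d≤ : d ≤ length Q-pool + 1
      d≤ = ≤-trans deg-w (length-filter-∉ [ u ] (nbr-unique w V!))

    |P| : length P ≡ k'
    |P| = length-take-≤ k' P-pool (+-cancelʳ-≤ m' k' (length P-pool) (≤-pred (subst (d ≤_) (+-suc (length P-pool) m') d≤)))
      where
      d≤ : d ≤ length P-pool + suc m'
      d≤ = ≤-trans deg-u (subst (λ n → _ ≤ length P-pool + suc n) |Q| (length-filter-∉ (w ∷ Q) (nbr-unique u V!)))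

    L! : Unique (u ∷ w ∷ P ++ Q)
    L! = (≢-sym w≢u ∷ Allₚ.++⁺ (All.map (≢-sym ∘ proj₁ ∘ proj₂) P-facts)
                             (All.map (λ (x∉[u] , _) u≡x → x∉[u] (here (sym u≡x))) Q-facts))
       ∷ Allₚ.++⁺ (All.map (λ (x∉wQ , _) w≡x → x∉wQ (here (sym w≡x))) P-facts)
                 (All.map (≢-sym ∘ proj₁ ∘ proj₂) Q-facts)
       ∷ AllPairsₚ.++⁺ P! Q! (All.map (λ (x∉wQ , _) → Allₚ.¬Any⇒All¬ Q (x∉wQ ∘ there)) P-facts)
      where
      P! : Unique P
      P! = Unique.take⁺ k' (Unique.filter⁺ (_∉? w ∷ Q) (nbr-unique u V!))
      Q! : Unique Q
      Q! = Unique.take⁺ m' (Unique.filter⁺ (_∉? [ u ]) (nbr-unique w V!))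

  -- Unless B_{k,m} embeds, every nonempty V has a vertex of degree ≤ e in V:
  -- if u has larger degree, then its neighbour w must have degree ≤ e.
  low-degree-vertex : ∀ {V} → Unique V → ∀ {u} → u ∈ V →
                      Embeds (B k m) E ⊎ Σ X λ v → v ∈ V × length (nbr v V) ≤ e
  low-degree-vertex {V} V! {u} u∈V with length (nbr u V) ≤? e
  ... | yes u-low = inj₂ (u , u∈V , u-low)
  ... | no u-high with member (nbr u V) (≤-trans (s≤s z≤n) (≰⇒> u-high))
  ... | w , w∈nbr with ∈-filter⁻ (Adjacent? u) w∈nbr
  ... | w∈V , u∼w with length (nbr w V) ≤? e
  ... | yes w-low = inj₂ (w , w∈V , w-low)
  ... | no w-high = inj₁ (bistar-from-degrees V! u∼w (≰⇒> u-high) (≰⇒> w-high))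

  Independent : X → X → Set
  Independent x y = x ≢ y × ¬ E x y

  remote : X → List X → List X
  remote v V = filter (_∉? v ∷ nbr v V) V

  remote-independent : ∀ {v V x} → x ∈ remote v V → x ∈ V × Independent v x
  remote-independent {v} {V} {x} x∈ with ∈-filter⁻ (_∉? v ∷ nbr v V) {xs = V} x∈
  ... | x∈V , x∉N =
    x∈V , (λ v≡x → x∉N (here (sym v≡x))) , (λ Evx → x∉N (there (∈-filter⁺ (Adjacent? v) x∈V (x≢v , Evx))))
    where
    x≢v : x ≢ v
    x≢v x≡v = x∉N (here x≡v)

  -- Deleting the closed neighbourhood of a vertex of degree ≤ e removes at most d
  -- vertices, so if more than (t+1)·d vertices remain before, more than t·d remain after.
  remote-large : ∀ t {V} → Unique V → ∀ v → length (nbr v V) ≤ e → suc t * d < length V →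
                 t * d < length (remote v V)
  remote-large t {V} V! v low big = +-cancelʳ-< d (t * d) (length (remote v V)) (begin-strict
    t * d + d                        ≡⟨ +-comm (t * d) d ⟩
    d + t * d                        <⟨ big ⟩
    length V                         ≤⟨ length-filter-∉ (v ∷ nbr v V) V! ⟩
    length (remote v V) + suc (length (nbr v V)) ≤⟨ +-monoʳ-≤ (length (remote v V)) (s≤s low) ⟩
    length (remote v V) + d          ∎)
    where open ≤-Reasoning

  -- Greedy independent set: repeatedly keep a vertex of degree ≤ e and delete its
  -- closed neighbourhood.  The kept vertices lie in V (the induction invariant).
  greedy : ∀ t V → Unique V → t * d < length V →
           Embeds (B k m) E ⊎ Σ (List X) λ I → length I ≡ suc t × AllPairs Independent I × All (_∈ V) I
  greedy t [] _ ()
  greedy zero (u ∷ _) _ _ = inj₂ (u ∷ [] , refl , [] ∷ [] , here refl ∷ [])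
  greedy (suc t) V@(_ ∷ _) V! big with low-degree-vertex V! (here refl)
  ... | inj₁ bistar = inj₁ bistar
  ... | inj₂ (v , v∈V , low)
        with greedy t (remote v V) (Unique.filter⁺ (_∉? v ∷ nbr v V) V!) (remote-large t V! v low big)
  ... | inj₁ bistar = inj₁ bistar
  ... | inj₂ (I , |I| , I! , I⊆) = inj₂ (v ∷ I , cong suc |I| ,
          All.map (proj₂ ∘ remote-independent) I⊆ ∷ I! , v∈V ∷ All.map (proj₁ ∘ remote-independent) I⊆)

  record IndependentSet (n : ℕ) : Set where
    field
      vertex      : Fin n → X
      injective   : Injective _≡_ _≡_ vertex
      independent : ∀ a b → a ≢ b → ¬ E (vertex a) (vertex b)

  bistar-or-independent : ∀ t V → Unique V → t * d < length V → Embeds (B k m) E ⊎ IndependentSet (suc t)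
  bistar-or-independent t V V! big with greedy t V V! big
  ... | inj₁ bistar = inj₁ bistar
  ... | inj₂ ([] , () , _)
  ... | inj₂ (I@(x ∷ _) , |I| , I! , _) = inj₂ record
    { vertex      = λ a → nth x I (toℕ a)
    ; injective   = λ {a} {b} eq →
        toℕ-injective (nth-injective x (AllPairs.map proj₁ I!) (in-range a) (in-range b) eq)
    ; independent = λ a b a≢b →
        proj₂ (nth-AllPairs independent-sym x I! (in-range a) (in-range b) (a≢b ∘ toℕ-injective))
    }
    where
    in-range : ∀ (a : Fin (suc t)) → toℕ a < length I
    in-range a = subst (toℕ a <_) (sym |I|) (toℕ<n a)
    independent-sym : ∀ {y z} → Independent y z → Independent z y
    independent-sym (y≢z , ¬Eyz) = ≢-sym y≢z , ¬Eyz ∘ E-sym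

K-edge⇒distinct : ∀ ns j {u v} → Adj (lookup (map K ns) j) u v → u ≢ v
K-edge⇒distinct (_ ∷ _) zero u≢v = u≢v
K-edge⇒distinct (_ ∷ ns) (suc j) uv = K-edge⇒distinct ns j uv

distinct⇒K-edge : ∀ ns j {u v} → u ≢ v → Adj (lookup (map K ns) j) u v
distinct⇒K-edge (_ ∷ _) zero u≢v = u≢v
distinct⇒K-edge (_ ∷ ns) (suc j) u≢v = distinct⇒K-edge ns j u≢v

-- Each K_{n_j} with n_j ≥ 2 has a vertex, so it has no copy in K_0.
K-vertex : ∀ {ns} → All (2 ≤_) ns → ∀ j → Fin (size (lookup (map K ns) j))
K-vertex (s≤s (s≤s _) ∷ _) zero = zero
K-vertex (_ ∷ ns≥2) (suc j) = K-vertex ns≥2 j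

no-arrows-at-0 : ∀ {ns} → All (2 ≤_) ns → ¬ Arrows 0 (map K ns)
no-arrows-at-0 ns≥2 arrows with arrows record { col = λ () ; sym = λ () }
... | j , f , _ with f (K-vertex ns≥2 j)
... | ()

-- Drop colour 0 from Fin (suc s): colour suc j becomes j; colour 0 (which will
-- never be used) becomes an arbitrary colour j₀.
unshift : ∀ {s} → Fin s → Fin (suc s) → Fin s
unshift j₀ zero = j₀
unshift j₀ (suc j) = j

unshift-nonzero : ∀ {s} (j₀ : Fin s) {x j} → x ≢ zero → unshift j₀ x ≡ j → x ≡ suc j
unshift-nonzero j₀ {zero} x≢0 _ = ⊥-elim (x≢0 refl)
unshift-nonzero j₀ {suc x} _ x≡j = cong suc x≡j

upper-bound : ∀ k' m' ns t → Fin (length (map K ns)) → Arrows (suc t) (map K ns) →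
              Arrows (suc (t * suc (k' + m'))) (B (suc k') (suc m') ∷ map K ns)
upper-bound k' m' ns t j₀ arrows c =
  from-dichotomy (bistar-or-independent t (allFin N) (Unique.allFin⁺ N) many-vertices)
  where
  N : ℕ
  N = suc (t * suc (k' + m'))
  open BistarOrIndependent _≟_ (λ x y → col c x y ≡ zero) (λ x y → col c x y ≟ zero)
                           (λ {x} {y} cxy≡0 → trans (Colouring.sym c y x) cxy≡0) k' m'

  many-vertices : t * d < length (allFin N)
  many-vertices = ≤-reflexive (sym (length-tabulate (λ x → x)))

  restriction : IndependentSet (suc t) → Colouring (suc t) (length (map K ns))
  restriction I = record
    { col = λ a b → unshift j₀ (col c (vertex a) (vertex b))
    ; sym = λ a b → cong (unshift j₀) (Colouring.sym c (vertex a) (vertex b)) }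
    where open IndependentSet I

  lift : (I : IndependentSet (suc t)) → SomeMonoCopy (map K ns) (restriction I) →
         SomeMonoCopy (B (suc k') (suc m') ∷ map K ns) c
  lift I (j , h , h-injective , h-edge) = suc j , vertex ∘ h , h-injective ∘ injective , edge
    where
    open IndependentSet I
    edge : ∀ u v → Adj (lookup (map K ns) j) u v → col c (vertex (h u)) (vertex (h v)) ≡ suc j
    edge u v uv = unshift-nonzero j₀
      (independent (h u) (h v) (K-edge⇒distinct ns j uv ∘ h-injective)) (h-edge u v uv)

  from-dichotomy : Embeds (B k m) (λ x y → col c x y ≡ zero) ⊎ IndependentSet (suc t) →
                   SomeMonoCopy (B (suc k') (suc m') ∷ map K ns) c
  from-dichotomy (inj₁ bistar) = zero , bistar
  from-dichotomy (inj₂ I) = lift I (arrows (restriction I))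

-- B_{k,m} is connected: a map constant along its edges is constant
-- (every vertex is within distance 2 of the centre at position 0).
bistar-connected : ∀ {Y : Set} k' m' (φ : Fin (suc k' + suc m') → Y) →
                   (∀ a b → Adj (B (suc k') (suc m')) a b → φ a ≡ φ b) → ∀ a → φ a ≡ φ zero
bistar-connected k' m' φ φ-edge a with toℕ a in a≡
... | zero = cong φ (toℕ-injective a≡)
... | suc zero = sym (φ-edge zero a (inj₁ (inj₁ (refl , a≡))))
... | suc (suc y) with suc (suc y) <? suc k' + 1
...   | yes a<k+1 = sym (φ-edge zero a (inj₁ (inj₂ (inj₁
          (refl , subst (2 ≤_) (sym a≡) (s≤s (s≤s z≤n)) , subst (_< suc k' + 1) (sym a≡) a<k+1)))))
...   | no a≮k+1 = trans (sym (φ-edge w a (inj₁ (inj₂ (inj₂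
          (toℕ-fromℕ< 1<k+m , subst (suc k' + 1 ≤_) (sym a≡) (≮⇒≥ a≮k+1)))))))
          (sym (φ-edge zero w (inj₁ (inj₁ (refl , toℕ-fromℕ< 1<k+m)))))
  where
  1<k+m : 1 < suc k' + suc m'
  1<k+m = s≤s (≤-trans (s≤s z≤n) (m≤n+m (suc m') k'))
  w : Fin (suc k' + suc m')
  w = fromℕ< 1<k+m

module BlowUp {t s} (c₀ : Colouring t s) where

  between : Fin t → Fin t → Fin (suc s)
  between p q with p ≟ q
  ... | yes _ = zero
  ... | no _ = suc (col c₀ p q)

  between-sym : ∀ p q → between p q ≡ between q p
  between-sym p q with p ≟ q | q ≟ p
  ... | yes _ | yes _ = refl
  ... | yes p≡q | no q≢p = ⊥-elim (q≢p (sym p≡q))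
  ... | no p≢q | yes q≡p = ⊥-elim (p≢q (sym q≡p))
  ... | no _ | no _ = cong suc (Colouring.sym c₀ p q)

  between-zero : ∀ {p q} → between p q ≡ zero → p ≡ q
  between-zero {p} {q} _ with p ≟ q
  between-zero _ | yes p≡q = p≡q
  between-zero () | no _

  between-suc : ∀ {p q j} → between p q ≡ suc j → p ≢ q × col c₀ p q ≡ j
  between-suc {p} {q} _ with p ≟ q
  between-suc () | yes _
  between-suc c≡j | no p≢q = p≢q , suc-injective c≡j

  blow-up : ∀ {N} → (Fin N → Fin t) → Colouring N (suc s)
  blow-up block = record
    { col = λ x y → between (block x) (block y)
    ; sym = λ x y → between-sym (block x) (block y) }

-- Lower bound: from a colouring of K_t without monochromatic K_{n_j} and N ≤ t(k+m-1),
-- the blow-up into blocks of size k+m-1 has no copy of B_{k,m} or K_{n_j} either.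
lower-bound : ∀ k' m' ns t N → N ≤ t * suc (k' + m') →
              Arrows N (B (suc k') (suc m') ∷ map K ns) → Arrows t (map K ns)
lower-bound k' m' ns t N N≤ arrows c₀ = project (arrows (blow-up block))
  where
  open BlowUp c₀
  d : ℕ
  d = suc (k' + m')

  -- a vertex of K_N as (block, offset within the block)
  position : Fin N → Fin t × Fin d
  position x = remQuot d (inject≤ x N≤)

  position-injective : ∀ {x y} → position x ≡ position y → x ≡ y
  position-injective {x} {y} eq = inject≤-injective N≤ N≤ x y (begin
    inject≤ x N≤                   ≡⟨ sym (combine-remQuot {t} d (inject≤ x N≤)) ⟩
    uncurry combine (position x)   ≡⟨ cong (uncurry combine) eq ⟩
    uncurry combine (position y)   ≡⟨ combine-remQuot {t} d (inject≤ y N≤) ⟩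
    inject≤ y N≤                   ∎)
    where open ≡-Reasoning

  block : Fin N → Fin t
  block = proj₁ ∘ position

  offset : Fin N → Fin d
  offset = proj₂ ∘ position

  -- a colour-0 copy of B_{k,m} lies in one block, so its offsets are distinct:
  -- k+m distinct offsets among d = k+m-1, impossible
  no-bistar : MonoCopy (blow-up block) zero (B (suc k') (suc m')) → ⊥
  no-bistar (f , f-injective , f-edge) = <⇒≱ d<k+m (injective⇒≤ offset-injective)
    where
    d<k+m : d < suc k' + suc m'
    d<k+m = s≤s (≤-reflexive (sym (+-suc k' m')))
    same-block : ∀ a → block (f a) ≡ block (f zero)
    same-block = bistar-connected k' m' (block ∘ f) (λ a b ab → between-zero (f-edge a b ab))
    offset-injective : ∀ {a b} → offset (f a) ≡ offset (f b) → a ≡ b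
    offset-injective {a} {b} eq =
      f-injective (position-injective (cong₂ _,_ (trans (same-block a) (sym (same-block b))) eq))

  project : SomeMonoCopy (B (suc k') (suc m') ∷ map K ns) (blow-up block) → SomeMonoCopy (map K ns) c₀
  project (zero , bistar) = ⊥-elim (no-bistar bistar)
  project (suc j , f , f-injective , f-edge) = j , block ∘ f , block-injective , edge
    where
    -- distinct vertices of K_{n_j} get colour j+1, hence lie in distinct blocks
    block-injective : ∀ {a b} → block (f a) ≡ block (f b) → a ≡ b
    block-injective {a} {b} eq with a ≟ b
    ... | yes a≡b = a≡b
    ... | no a≢b = ⊥-elim (proj₁ (between-suc (f-edge a b (distinct⇒K-edge ns j a≢b))) eq)
    edge : ∀ u v → Adj (lookup (map K ns) j) u v → col c₀ (block (f u)) (block (f v)) ≡ j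
    edge u v uv = proj₂ (between-suc (f-edge u v uv))

-- With r = t+1: the upper bound gives the arrow property at t(k+m-1)+1 (the list ns is
-- nonempty, which supplies the spare colour j₀ = zero), the lower bound its minimality.
theorem10 : (k m : ℕ) → 1 ≤ k → 1 ≤ m →
    (ns : List ℕ) → 1 ≤ length ns → All (2 ≤_) ns →
    (r : ℕ) → IsRamseyNumber r (map K ns) →
    IsRamseyNumber ((k + m ∸ 1) * (r ∸ 1) + 1) (B k m ∷ map K ns)
theorem10 (suc k') (suc m') _ _ ns@(_ ∷ _) _ ns≥2 zero (arrows , _) =
  ⊥-elim (no-arrows-at-0 ns≥2 arrows)
theorem10 (suc k') (suc m') _ _ ns@(_ ∷ _) _ _ (suc t) (arrows , minimal) =
  subst (λ N → Arrows N (B (suc k') (suc m') ∷ map K ns)) value≡ (upper-bound k' m' ns t zero arrows) ,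
  least
  where
  d : ℕ
  d = suc (k' + m')

  value≡ : suc (t * d) ≡ (k' + suc m') * t + 1
  value≡ = begin
    suc (t * d)            ≡⟨ +-comm 1 (t * d) ⟩
    t * d + 1              ≡⟨ cong (_+ 1) (*-comm t d) ⟩
    d * t + 1              ≡⟨ cong (λ n → n * t + 1) (sym (+-suc k' m')) ⟩
    (k' + suc m') * t + 1  ∎
    where open ≡-Reasoning

  -- fewer vertices would, by the blow-up, give R(K_{n_1},…) ≤ t
  least : ∀ N → Arrows N (B (suc k') (suc m') ∷ map K ns) → (k' + suc m') * t + 1 ≤ N
  least N arrows-N with N ≤? t * d
  ... | yes few = ⊥-elim (n≮n t (minimal t (lower-bound k' m' ns t N few arrows-N)))
  ... | no many = subst (_≤ N) value≡ (≰⇒> many)
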